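{- Let $m\ge1$ and let $\mathbf{u}=\lim_{k\to\infty}\varphi^k(0)$ be the fixed point of the substitution $\varphi$ on the alphabet $\{0,1,\dots,m-1\}$ given by $\varphi(\ell)=0^{\alpha_\ell}(\ell+1)$ for $0\le\ell\le m-2$ and $\varphi(m-1)=0^{\alpha_{m-1}}$, where the nonnegative integers $\alpha_0,\dots,\alpha_{m-1}$ satisfy the simple Parry conditions stated in the context. Set $$R_s=\begin{cases}m-1 & \text{if }\alpha_0\ge2,\\ m+\ell'-1,\ \text{where }\ell'=\min\{\ell\ge1:\alpha_\ell\ge1\} & \text{if }\alpha_0=1.\end{cases}$$ Then $\varphi^{R_s}(0)0$ is a prefix of $\mathbf{u}$, and every factor of $\mathbf{u}$ of the form $0t0$, where $t$ is a (possibly empty) word not containing the letter $0$, is a factor of $\varphi^{R_s}(0)0$.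
   Context: Simple Parry conditions: $\alpha_{m-1}\ge1$ and, for every $1\le i\le m-1$, $\alpha_i\alpha_{i+1}\cdots\alpha_{m-1}0^\omega$ is lexicographically strictly smaller than $\alpha_0\alpha_1\cdots\alpha_{m-1}0^\omega$ (i.e. $\alpha_0\cdots\alpha_{m-1}$ is the Rényi expansion of $1$ in base a simple Parry number); moreover $\varphi$ is a genuine substitution (some image has length $>1$). These conditions imply $\alpha_0\ge1$ and $\alpha_\ell\le\alpha_0$ for all $\ell$. $\varphi$ is extended to words as a monoid morphism; $0^{a}$ denotes $a$ copies of the letter $0$; letters are identified with integers. -}

module Defs where

open import Data.Nat using (ℕ; zero; suc; _+_; _∸_; _≤_; _<_; _<ᵇ_)
open import Data.Bool using (if_then_else_)
open import Data.List using (List; []; _∷_; _++_; replicate; concatMap; length)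
open import Data.List.Relation.Unary.All using (All)
open import Data.Maybe using (Maybe; just; nothing)
open import Data.Product using (Σ; ∃; ∃-syntax; _×_)
open import Relation.Binary.PropositionalEquality using (_≡_; _≢_)
open import Relation.Nullary using (¬_)

Word : Set
Word = List ℕ

-- The substitution φ(ℓ) = 0^{α ℓ} (ℓ+1) for ℓ ≤ m-2, φ(m-1) = 0^{α (m-1)}.
-- (Values on letters ≥ m are irrelevant: they never occur.)
φ : (m : ℕ) (α : ℕ → ℕ) → ℕ → Word
φ m α ℓ = replicate (α ℓ) 0 ++ (if suc ℓ <ᵇ m then suc ℓ ∷ [] else [])

φ* : (m : ℕ) (α : ℕ → ℕ) → Word → Word
φ* m α = concatMap (φ m α)

φ^ : (m : ℕ) (α : ℕ → ℕ) → ℕ → Word → Word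
φ^ m α zero w = w
φ^ m α (suc k) w = φ* m α (φ^ m α k w)

at : Word → ℕ → Maybe ℕ
at [] n = nothing
at (x ∷ w) zero = just x
at (x ∷ w) (suc n) = at w n

tailSeq : (m : ℕ) (α : ℕ → ℕ) (i : ℕ) → ℕ → ℕ
tailSeq m α i n = if (i + n) <ᵇ m then α (i + n) else 0

_<lex_ : (ℕ → ℕ) → (ℕ → ℕ) → Set
s <lex t = ∃[ k ] ((∀ j → j < k → s j ≡ t j) × s k < t k)

-- Simple Parry conditions, plus φ being a genuine substitution
SimpleParry : (m : ℕ) (α : ℕ → ℕ) → Set
SimpleParry m α =
  (1 ≤ α (m ∸ 1))
  × (∀ i → 1 ≤ i → i ≤ m ∸ 1 → tailSeq m α i <lex tailSeq m α 0)
  × (∃[ ℓ ] (ℓ < m × 1 < length (φ m α ℓ)))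

IsLimitFixedPoint : (m : ℕ) (α : ℕ → ℕ) → (ℕ → ℕ) → Set
IsLimitFixedPoint m α u =
  ∀ n → ∃[ K ] (∀ k → K ≤ k → at (φ^ m α k (0 ∷ [])) n ≡ just (u n))

IsPrefixOf∞ : Word → (ℕ → ℕ) → Set
IsPrefixOf∞ w u = ∀ i → i < length w → at w i ≡ just (u i)

IsFactorOf∞ : Word → (ℕ → ℕ) → Set
IsFactorOf∞ w u = ∃[ j ] (∀ i → i < length w → at w i ≡ just (u (j + i)))

IsFactor : Word → Word → Set
IsFactor w v = ∃[ x ] ∃[ y ] (x ++ w ++ y ≡ v)

Conclusion : (m : ℕ) (α : ℕ → ℕ) (u : ℕ → ℕ) (R : ℕ) → Set
Conclusion m α u R =
  IsPrefixOf∞ (φ^ m α R (0 ∷ []) ++ 0 ∷ []) u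
  × (∀ (t : Word) → All (λ a → a ≢ 0) t →
       IsFactorOf∞ (0 ∷ t ++ 0 ∷ []) u →
       IsFactor (0 ∷ t ++ 0 ∷ []) (φ^ m α R (0 ∷ []) ++ 0 ∷ []))

module Submission where

-- Write Bₖ = φᵏ(0). The proof only uses α₀ ≥ 1 and two facts about the
-- iterates, for some threshold L with R = L + m - 1:
--   (prefix chain)  Bₖ0 is a prefix of Bₖ₊₁ for every k ≥ L;
--   (unfolding)     Bₖ₊₁ = B_k^{α₀} B_{k-1}^{α₁} ⋯ B_{k+1-m}^{α_{m-1}}.
-- Call w *covered* if every 0t0 (t zero-free) occurring in w0 occurs in
-- B_R0. Covered words are closed under concatenation with a right factor
-- that is empty or begins with 0, because a 0t0 occurring across the junction
-- is cut at the 0 starting the right factor. The prefix chain gives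
-- coverage of Bₖ for L ≤ k ≤ R; the unfolding propagates it to all k ≥ L
-- by strong induction. Finally u agrees with Bₖ on any finite window for
-- large k, which transfers prefix and factor statements to u.
-- The prefix chain holds with L = 0 if α₀ ≥ 2 (φ(0) = 00⋯) and with
-- L = ℓ' if α₀ = 1 (φ(0) = 01 and φ^{ℓ'}(1) begins with 0).

open import Defs
open import Data.Nat using (ℕ; zero; suc; _+_; _∸_; _≤_; _<_; z≤n; s≤s; _<ᵇ_; _⊔_)
open import Data.Nat.Properties
open import Data.Nat.Induction using (<-rec)
open import Data.Bool using (true; false; if_then_else_)
open import Data.Bool.Properties using (T-≡)
open import Data.List using ([]; _∷_; _++_; replicate; length)
open import Data.List.Properties using (++-assoc; ++-identityʳ; ∷-injectiveˡ; ∷-injectiveʳ; concatMap-++)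
open import Data.List.Relation.Unary.All using (All; _∷_)
open import Data.Maybe using (just)
open import Data.Product using (∃-syntax; _×_; _,_; proj₁; proj₂)
open import Data.Sum using (_⊎_; inj₁; inj₂)
open import Data.Empty using (⊥-elim)
open import Function.Bundles using (Equivalence)
open import Relation.Binary.PropositionalEquality
open import Relation.Nullary using (¬_; yes; no)

_^ʷ_ : Word → ℕ → Word
w ^ʷ zero = []
w ^ʷ suc n = w ++ w ^ʷ n

StartsWith0 : Word → Set
StartsWith0 w = ∃[ w' ] (w ≡ 0 ∷ w')

-- the right factors along which coverage can be glued
EmptyOr0 : Word → Set
EmptyOr0 w = w ≡ [] ⊎ StartsWith0 w

_⊑_ : Word → Word → Set
x ⊑ y = ∃[ z ] (x ++ z ≡ y)

ZeroFree : Word → Set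
ZeroFree = All (_≢ 0)

framed : Word → Word
framed t = 0 ∷ t ++ 0 ∷ []

replicate-starts : ∀ {n w} → 1 ≤ n → StartsWith0 (replicate n 0 ++ w)
replicate-starts {suc n} _ = _ , refl

replicate-starts² : ∀ {n w} → 2 ≤ n → ∃[ v ] (replicate n 0 ++ w ≡ 0 ∷ v × StartsWith0 v)
replicate-starts² {suc (suc n)} _ = _ , refl , (_ , refl)
replicate-starts² {suc zero} (s≤s ())

starts-++ : ∀ {x} y → StartsWith0 x → StartsWith0 (x ++ y)
starts-++ y (x' , refl) = x' ++ y , refl

emptyOr0-++ : ∀ {x y} → EmptyOr0 x → EmptyOr0 y → EmptyOr0 (x ++ y)
emptyOr0-++ (inj₁ refl) ey = ey
emptyOr0-++ {y = y} (inj₂ sx) _ = inj₂ (starts-++ y sx)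

⊑-trans : ∀ {x y z} → x ⊑ y → y ⊑ z → x ⊑ z
⊑-trans {x} (a , refl) (b , refl) = a ++ b , sym (++-assoc x a b)

⊑-0 : ∀ w r → (w ++ 0 ∷ []) ⊑ (w ++ 0 ∷ r)
⊑-0 w r = r , ++-assoc w (0 ∷ []) r

factor-⊑ : ∀ {w x y} → IsFactor w x → x ⊑ y → IsFactor w y
factor-⊑ {w} (a , b , refl) (z , refl) =
  a , b ++ z , trans (cong (a ++_) (sym (++-assoc w b z))) (sym (++-assoc a (w ++ b) z))

at-++ˡ : ∀ x z i → i < length x → at (x ++ z) i ≡ at x i
at-++ˡ (c ∷ x) z zero _ = refl
at-++ˡ (c ∷ x) z (suc i) (s≤s p) = at-++ˡ x z i p

⊑-by-letters : ∀ w f → (∀ i → i < length f → at w i ≡ at f i) → f ⊑ w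
⊑-by-letters w [] _ = w , refl
⊑-by-letters [] (c ∷ f) h with h 0 (s≤s z≤n)
... | ()
⊑-by-letters (c' ∷ w) (c ∷ f) h with h 0 (s≤s z≤n)
... | refl with ⊑-by-letters w f (λ i p → h (suc i) (s≤s p))
... | y , e = y , cong (c ∷_) e

factor-by-letters : ∀ w j f → (∀ i → i < length f → at w (j + i) ≡ at f i) → IsFactor f w
factor-by-letters w zero f h with ⊑-by-letters w f h
... | y , e = [] , y , e
factor-by-letters [] (suc j) [] _ = [] , [] , refl
factor-by-letters [] (suc j) (c ∷ f) h with h 0 (s≤s z≤n)
... | ()
factor-by-letters (c' ∷ w) (suc j) f h with factor-by-letters w j f h
... | x , y , e = c' ∷ x , y , cong (c' ∷_) e

zeroFree-⊑ : ∀ t q x r → ZeroFree t → (t ++ 0 ∷ []) ++ q ≡ x ++ 0 ∷ r →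
             (t ++ 0 ∷ []) ⊑ (x ++ 0 ∷ [])
zeroFree-⊑ [] q [] r _ _ = [] , refl
zeroFree-⊑ [] q (c ∷ x) r _ eq = x ++ 0 ∷ [] , cong (_∷ (x ++ 0 ∷ [])) (∷-injectiveˡ eq)
zeroFree-⊑ (a ∷ t) q [] r (a≢0 ∷ _) eq = ⊥-elim (a≢0 (∷-injectiveˡ eq))
zeroFree-⊑ (a ∷ t) q (c ∷ x) r (_ ∷ nz) eq with zeroFree-⊑ t q x r nz (∷-injectiveʳ eq)
... | q' , e = q' , cong₂ _∷_ (∷-injectiveˡ eq) e

framed-split : ∀ t p q x r → ZeroFree t → p ++ framed t ++ q ≡ x ++ 0 ∷ r →
               IsFactor (framed t) (x ++ 0 ∷ []) ⊎ IsFactor (framed t) (0 ∷ r)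
framed-split t p q [] r _ eq = inj₂ (p , q , eq)
framed-split t [] q (c ∷ x) r nz eq with zeroFree-⊑ t q x r nz (∷-injectiveʳ eq)
... | q' , e = inj₁ ([] , q' , cong₂ _∷_ (∷-injectiveˡ eq) e)
framed-split t (d ∷ p) q (c ∷ x) r nz eq with framed-split t p q x r nz (∷-injectiveʳ eq)
... | inj₁ (x₀ , y₀ , e) = inj₁ (c ∷ x₀ , y₀ , cong (c ∷_) e)
... | inj₂ f = inj₂ f

-- a return word has length ≥ 2
framed-not-in-0 : ∀ t → ¬ IsFactor (framed t) (0 ∷ [])
framed-not-in-0 [] ([] , y , ())
framed-not-in-0 (a ∷ t) ([] , y , ())
framed-not-in-0 t (c ∷ [] , y , ())
framed-not-in-0 t (c ∷ d ∷ x , y , ())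

module Covering (T : Word) where

  Covered : Word → Set
  Covered w = ∀ t → ZeroFree t → IsFactor (framed t) (w ++ 0 ∷ []) → IsFactor (framed t) T

  -- the pieces out of which the iterates are glued
  Block : Word → Set
  Block w = Covered w × EmptyOr0 w

  -- 0 alone contains no return word
  block-[] : Block []
  block-[] = (λ t _ f → ⊥-elim (framed-not-in-0 t f)) , inj₁ refl

  -- the gluing step: a return word in xy0 with y = 0y' lies in x0 or in y0
  covered-++ : ∀ {x y} → Covered x → Block y → Covered (x ++ y)
  covered-++ {x} cx (_ , inj₁ refl) t nz f =
    cx t nz (subst (IsFactor (framed t)) (cong (_++ 0 ∷ []) (++-identityʳ x)) f)
  covered-++ {x} cx (cy , inj₂ (y' , refl)) t nz (p , q , eq)
    with framed-split t p q x (y' ++ 0 ∷ []) nz (trans eq (++-assoc x (0 ∷ y') (0 ∷ [])))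
  ... | inj₁ f = cx t nz f
  ... | inj₂ f = cy t nz f

  block-++ : ∀ {x y} → Block x → Block y → Block (x ++ y)
  block-++ (cx , ex) by = covered-++ cx by , emptyOr0-++ ex (proj₂ by)

  block-^ : ∀ {w} n → Covered w → StartsWith0 w → Block (w ^ʷ n)
  block-^ zero _ _ = block-[]
  block-^ (suc n) cw sw = block-++ (cw , inj₂ sw) (block-^ n cw sw)

<ᵇ-true : ∀ {k n} → k < n → (k <ᵇ n) ≡ true
<ᵇ-true k<n = Equivalence.to T-≡ (<⇒<ᵇ k<n)

<ᵇ-false : ∀ {k n} → n ≤ k → (k <ᵇ n) ≡ false
<ᵇ-false {k} {zero} _ = refl
<ᵇ-false {suc k} {suc n} (s≤s n≤k) = <ᵇ-false n≤k

module Iterates (m : ℕ) (α : ℕ → ℕ) where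

  B : ℕ → Word
  B k = φ^ m α k (0 ∷ [])

  φ-inner : ∀ {ℓ} → suc ℓ < m → φ m α ℓ ≡ replicate (α ℓ) 0 ++ suc ℓ ∷ []
  φ-inner {ℓ} p = cong (λ b → replicate (α ℓ) 0 ++ (if b then suc ℓ ∷ [] else [])) (<ᵇ-true p)

  φ-last : ∀ {ℓ} → m ≤ suc ℓ → φ m α ℓ ≡ replicate (α ℓ) 0 ++ []
  φ-last {ℓ} p = cong (λ b → replicate (α ℓ) 0 ++ (if b then suc ℓ ∷ [] else [])) (<ᵇ-false p)

  φ^-++ : ∀ k x y → φ^ m α k (x ++ y) ≡ φ^ m α k x ++ φ^ m α k y
  φ^-++ zero x y = refl
  φ^-++ (suc k) x y =
    trans (cong (φ* m α) (φ^-++ k x y)) (concatMap-++ (φ m α) (φ^ m α k x) (φ^ m α k y))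

  φ^-[] : ∀ k → φ^ m α k [] ≡ []
  φ^-[] zero = refl
  φ^-[] (suc k) = cong (φ* m α) (φ^-[] k)

  φ^-letter : ∀ k a → φ^ m α (suc k) (a ∷ []) ≡ φ^ m α k (φ m α a)
  φ^-letter k a = trans (outer k (a ∷ [])) (cong (φ^ m α k) (++-identityʳ (φ m α a)))
    where
    outer : ∀ k w → φ^ m α (suc k) w ≡ φ^ m α k (φ* m α w)
    outer zero w = refl
    outer (suc k) w = cong (φ* m α) (outer k w)

  φ^-zeros : ∀ k n → φ^ m α k (replicate n 0) ≡ B k ^ʷ n
  φ^-zeros k zero = φ^-[] k
  φ^-zeros k (suc n) = trans (φ^-++ k (0 ∷ []) (replicate n 0)) (cong (B k ++_) (φ^-zeros k n))

  φ^-inner : ∀ k {ℓ} → suc ℓ < m → φ^ m α (suc k) (ℓ ∷ []) ≡ B k ^ʷ α ℓ ++ φ^ m α k (suc ℓ ∷ [])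
  φ^-inner k {ℓ} p = begin
    φ^ m α (suc k) (ℓ ∷ [])                                ≡⟨ φ^-letter k ℓ ⟩
    φ^ m α k (φ m α ℓ)                                      ≡⟨ cong (φ^ m α k) (φ-inner p) ⟩
    φ^ m α k (replicate (α ℓ) 0 ++ suc ℓ ∷ [])              ≡⟨ φ^-++ k (replicate (α ℓ) 0) _ ⟩
    φ^ m α k (replicate (α ℓ) 0) ++ φ^ m α k (suc ℓ ∷ [])  ≡⟨ cong (_++ φ^ m α k (suc ℓ ∷ [])) (φ^-zeros k (α ℓ)) ⟩
    B k ^ʷ α ℓ ++ φ^ m α k (suc ℓ ∷ [])                    ∎
    where open ≡-Reasoning

  φ^-last : ∀ k {ℓ} → m ≤ suc ℓ → φ^ m α (suc k) (ℓ ∷ []) ≡ B k ^ʷ α ℓ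
  φ^-last k {ℓ} p = begin
    φ^ m α (suc k) (ℓ ∷ [])                       ≡⟨ φ^-letter k ℓ ⟩
    φ^ m α k (φ m α ℓ)                             ≡⟨ cong (φ^ m α k) (φ-last p) ⟩
    φ^ m α k (replicate (α ℓ) 0 ++ [])             ≡⟨ φ^-++ k (replicate (α ℓ) 0) [] ⟩
    φ^ m α k (replicate (α ℓ) 0) ++ φ^ m α k []    ≡⟨ cong₂ _++_ (φ^-zeros k (α ℓ)) (φ^-[] k) ⟩
    B k ^ʷ α ℓ ++ []                               ≡⟨ ++-identityʳ _ ⟩
    B k ^ʷ α ℓ                                     ∎
    where open ≡-Reasoning

  φ-starts : ∀ ℓ → 1 ≤ α ℓ → StartsWith0 (φ m α ℓ)
  φ-starts ℓ = replicate-starts {α ℓ}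

  φ^-starts : 1 ≤ α 0 → ∀ k {w} → StartsWith0 w → StartsWith0 (φ^ m α k w)
  φ^-starts α₀≥1 zero sw = sw
  φ^-starts α₀≥1 (suc k) sw with φ^-starts α₀≥1 k sw
  ... | w' , e = subst StartsWith0 (sym (cong (φ* m α) e)) (starts-++ (φ* m α w') (φ-starts 0 α₀≥1))

  B-starts : 1 ≤ α 0 → ∀ k → StartsWith0 (B k)
  B-starts α₀≥1 k = φ^-starts α₀≥1 k ([] , refl)

  -- if φ(0) = 0w and φᵏ(w) begins with 0, then Bₖ0 is a prefix of Bₖ₊₁ = Bₖ φᵏ(w)
  prefix-step : ∀ {w} k → φ m α 0 ≡ 0 ∷ w → StartsWith0 (φ^ m α k w) → (B k ++ 0 ∷ []) ⊑ B (suc k)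
  prefix-step {w} k φ0 (c , ec) = subst ((B k ++ 0 ∷ []) ⊑_) (sym B[k+1]≡) (⊑-0 (B k) c)
    where
    B[k+1]≡ : B (suc k) ≡ B k ++ 0 ∷ c
    B[k+1]≡ = trans (φ^-letter k 0) (trans (cong (φ^ m α k) φ0)
                (trans (φ^-++ k (0 ∷ []) w) (cong (B k ++_) ec)))

  -- a letter j followed by letters of weight 0 up to a letter j+s of positive
  -- weight: φ^{s+1+k}(j) = φ^{k+1}(j+s) begins with 0
  chain-starts : 1 ≤ α 0 → ∀ s j k → j + s < m → (∀ i → j ≤ i → i < j + s → α i ≡ 0) →
                 1 ≤ α (j + s) → StartsWith0 (φ^ m α (suc (s + k)) (j ∷ []))
  chain-starts α₀≥1 zero j k _ _ pos =
    subst StartsWith0 (sym (φ^-letter k j))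
      (φ^-starts α₀≥1 k (φ-starts j (subst (λ i → 1 ≤ α i) (+-identityʳ j) pos)))
  chain-starts α₀≥1 (suc s) j k lt zeros pos =
    subst StartsWith0 (sym (trans (φ^-letter (suc (s + k)) j) (cong (φ^ m α (suc (s + k))) φj)))
      (chain-starts α₀≥1 s (suc j) k (subst (_< m) j+s+1 lt)
        (λ i p q → zeros i (<⇒≤ p) (subst (i <_) (sym j+s+1) q)) (subst (λ i → 1 ≤ α i) j+s+1 pos))
    where
    j+s+1 : j + suc s ≡ suc j + s
    j+s+1 = +-suc j s
    j<j+s+1 : j < j + suc s
    j<j+s+1 = m<m+n j (s≤s z≤n)
    φj : φ m α j ≡ suc j ∷ []
    φj = trans (φ-inner (≤-<-trans j<j+s+1 lt))
               (cong (λ n → replicate n 0 ++ suc j ∷ []) (zeros j ≤-refl j<j+s+1))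

  -- α₀ ≥ 2: φ(0) = 0w with w = 0⋯, so φᵏ(w) begins with 0 for every k
  prefix-chain-α₀≥2 : 2 ≤ α 0 → ∀ k → (B k ++ 0 ∷ []) ⊑ B (suc k)
  prefix-chain-α₀≥2 α₀≥2 k with replicate-starts² {α 0} α₀≥2
  ... | w , φ0 , sw = prefix-step k φ0 (φ^-starts (≤-trans (n≤1+n 1) α₀≥2) k sw)

  -- α₀ = 1: φ(0) = 01, and φᵏ(1) begins with 0 once k ≥ ℓ'
  prefix-chain-α₀≡1 : ∀ {ℓ'} → α 0 ≡ 1 → 1 ≤ ℓ' → ℓ' < m → (∀ j → 1 ≤ j → j < ℓ' → α j ≡ 0) →
                      1 ≤ α ℓ' → ∀ k → ℓ' ≤ k → (B k ++ 0 ∷ []) ⊑ B (suc k)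
  prefix-chain-α₀≡1 {suc s} α₀≡1 _ ℓ'<m zeros pos k ℓ'≤k = prefix-step k φ0
    (subst (λ n → StartsWith0 (φ^ m α n (1 ∷ []))) (m+[n∸m]≡n ℓ'≤k)
      (chain-starts (≤-reflexive (sym α₀≡1)) s 1 (k ∸ suc s) ℓ'<m zeros pos))
    where
    φ0 : φ m α 0 ≡ 0 ∷ 1 ∷ []
    φ0 = trans (φ-inner (<-≤-trans (s≤s (s≤s z≤n)) ℓ'<m)) (cong (λ n → replicate n 0 ++ 1 ∷ []) α₀≡1)

-- The core argument, for m = m'+1, assuming α₀ ≥ 1 and the prefix chain
-- from a threshold L on; the resulting bound is R = L + m'.

module ReturnWords (m' : ℕ) (α : ℕ → ℕ) (α₀≥1 : 1 ≤ α 0) (L : ℕ)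
                   (chain : ∀ k → L ≤ k → (Iterates.B (suc m') α k ++ 0 ∷ []) ⊑ Iterates.B (suc m') α (suc k))
                   where

  open Iterates (suc m') α

  R : ℕ
  R = L + m'

  B-⊑-later : ∀ j k → L ≤ k → (B k ++ 0 ∷ []) ⊑ B (suc (j + k))
  B-⊑-later zero k p = chain k p
  B-⊑-later (suc j) k p =
    ⊑-trans (B-⊑-later j k p) (⊑-trans (0 ∷ [] , refl) (chain (suc (j + k)) (≤-trans p (m≤n+m k (suc j)))))

  open Covering (B R ++ 0 ∷ [])

  -- Bₖ0 is a prefix of B_R0 for L ≤ k ≤ R
  covered-early : ∀ k → L ≤ k → k ≤ R → Covered (B k)
  covered-early k p q t nz f with m≤n⇒m<n∨m≡n q
  ... | inj₂ refl = f
  ... | inj₁ k<R = factor-⊑ f (⊑-trans (subst (λ n → (B k ++ 0 ∷ []) ⊑ B n) R≡ (B-⊑-later (R ∸ suc k) k p))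
                                       (0 ∷ [] , refl))
    where
    R≡ : suc (R ∸ suc k + k) ≡ R
    R≡ = trans (sym (+-suc (R ∸ suc k) k)) (m∸n+n≡m k<R)

  -- φ^{n+d+1}(a), for a + n = m', is glued from covered B_d, …, B_{n+d}
  block-unfold : ∀ n a d → a + n ≡ m' → (∀ i → d ≤ i → i ≤ n + d → Covered (B i)) →
                 Block (φ^ (suc m') α (suc (n + d)) (a ∷ []))
  block-unfold zero a d a≡m' cov =
    subst Block (sym (φ^-last d (≤-reflexive (cong suc (sym (trans (sym (+-identityʳ a)) a≡m'))))))
      (block-^ (α a) (cov d ≤-refl ≤-refl) (B-starts α₀≥1 d))
  block-unfold (suc n) a d a+n≡m' cov =
    subst Block (sym (φ^-inner k inner))
      (block-++ (block-^ (α a) (cov k (m≤n+m d (suc n)) ≤-refl) (B-starts α₀≥1 k))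
                (block-unfold n (suc a) d (trans (sym (+-suc a n)) a+n≡m')
                              (λ i p q → cov i p (m≤n⇒m≤1+n q))))
    where
    k = suc (n + d)
    inner : suc a < suc m'
    inner = s≤s (subst (suc a ≤_) a+n≡m' (subst (suc a ≤_) (sym (+-suc a n)) (s≤s (m≤m+n a n))))

  covered-all : ∀ k → L ≤ k → Covered (B k)
  covered-all = <-rec (λ k → L ≤ k → Covered (B k)) step
    where
    step : ∀ k → (∀ {i} → i < k → L ≤ i → Covered (B i)) → L ≤ k → Covered (B k)
    step k ih L≤k with k ≤? R
    ... | yes k≤R = covered-early k L≤k k≤R
    ... | no k≰R = subst (λ n → Covered (B n)) k≡ (proj₁ (block-unfold m' 0 d refl cov))
      where
      d : ℕ
      d = k ∸ suc m'
      L+m≤k : L + suc m' ≤ k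
      L+m≤k = subst (_≤ k) (sym (+-suc L m')) (≰⇒> k≰R)
      k≡ : suc (m' + d) ≡ k
      k≡ = m+[n∸m]≡n (≤-trans (m≤n+m (suc m') L) L+m≤k)
      L≤d : L ≤ d
      L≤d = subst (_≤ d) (m+n∸n≡m L (suc m')) (∸-monoˡ-≤ (suc m') L+m≤k)
      cov : ∀ i → d ≤ i → i ≤ m' + d → Covered (B i)
      cov i p q = ih (subst (i <_) k≡ (s≤s q)) (≤-trans L≤d p)

  module Limit (u : ℕ → ℕ) (lim : IsLimitFixedPoint (suc m') α u) where

    window : ∀ n → ∃[ K ] (∀ k → K ≤ k → ∀ p → p < n → at (B k) p ≡ just (u p))
    window zero = 0 , λ k _ p ()
    window (suc n) with window n | lim n
    ... | K₁ , h₁ | K₂ , h₂ = K₁ ⊔ K₂ , agree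
      where
      agree : ∀ k → K₁ ⊔ K₂ ≤ k → ∀ p → p < suc n → at (B k) p ≡ just (u p)
      agree k K≤k p (s≤s p≤n) with m≤n⇒m<n∨m≡n p≤n
      ... | inj₁ p<n = h₁ k (≤-trans (m≤m⊔n K₁ K₂) K≤k) p p<n
      ... | inj₂ refl = h₂ k (≤-trans (m≤n⊔m K₁ K₂) K≤k)

    -- B_R0 is a prefix of every B_k with k > R, hence of u
    prefix : IsPrefixOf∞ (B R ++ 0 ∷ []) u
    prefix i i<len with lim i
    ... | K , h with B-⊑-later K R (m≤m+n L m')
    ... | z , e = trans (sym (at-++ˡ (B R ++ 0 ∷ []) z i i<len))
                    (trans (cong (λ w → at w i) e) (h (suc (K + R)) (≤-trans (m≤m+n K R) (n≤1+n _))))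

    -- a return word of u occurs in some covered B_k
    factors : ∀ t → ZeroFree t → IsFactorOf∞ (framed t) u → IsFactor (framed t) (B R ++ 0 ∷ [])
    factors t nz (j , h) with window (j + length (framed t))
    ... | K , hK = covered-all k (m≤n⊔m K L) t nz
                     (factor-⊑ (factor-by-letters (B k) j (framed t) letters) (0 ∷ [] , refl))
      where
      k = K ⊔ L
      letters : ∀ i → i < length (framed t) → at (B k) (j + i) ≡ at (framed t) i
      letters i i<len = trans (hK k (m≤m⊔n K L) (j + i) (+-monoʳ-< j i<len)) (sym (h i i<len))

    conclusion : Conclusion (suc m') α u R
    conclusion = prefix , factors

proposition4p4 : (m : ℕ) → 1 ≤ m → (α : ℕ → ℕ) → SimpleParry m α →
    (u : ℕ → ℕ) → IsLimitFixedPoint m α u →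
    (2 ≤ α 0 → Conclusion m α u (m ∸ 1))
    × ((ℓ' : ℕ) → α 0 ≡ 1 → 1 ≤ ℓ' → ℓ' < m → 1 ≤ α ℓ' →
    (∀ j → 1 ≤ j → j < ℓ' → α j ≡ 0) →
    Conclusion m α u (m + ℓ' ∸ 1))
proposition4p4 (suc m') _ α _ u lim = case-α₀≥2 , case-α₀≡1
  where
  open Iterates (suc m') α

  -- R_s = m - 1 = 0 + m'
  case-α₀≥2 : 2 ≤ α 0 → Conclusion (suc m') α u m'
  case-α₀≥2 α₀≥2 = ReturnWords.Limit.conclusion m' α (≤-trans (n≤1+n 1) α₀≥2) 0
                     (λ k _ → prefix-chain-α₀≥2 α₀≥2 k) u lim

  -- R_s = m + ℓ' - 1 = ℓ' + m'
  case-α₀≡1 : (ℓ' : ℕ) → α 0 ≡ 1 → 1 ≤ ℓ' → ℓ' < suc m' → 1 ≤ α ℓ' →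
              (∀ j → 1 ≤ j → j < ℓ' → α j ≡ 0) → Conclusion (suc m') α u (suc m' + ℓ' ∸ 1)
  case-α₀≡1 ℓ' α₀≡1 1≤ℓ' ℓ'<m pos zeros =
    subst (Conclusion (suc m') α u) (+-comm ℓ' m')
      (ReturnWords.Limit.conclusion m' α (≤-reflexive (sym α₀≡1)) ℓ'
        (prefix-chain-α₀≡1 α₀≡1 1≤ℓ' ℓ'<m zeros pos) u lim)
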